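{- (1) For every game $G$, the pair $(\mathsf{ts}(G),\simeq_G)$, where $\mathsf{ts}(G)$ is the set of all t-skeletons on $G$, is a complete pair, and $G=(\bigcup\mathsf{ts}(G),\simeq_G)$. (2) For every complete pair $(\mathcal S,\simeq)$, the t-skeletons on the union game $(\bigcup\mathcal S,\simeq)$ are precisely the elements of $\mathcal S$.
   Context: A move is a triple $(m,x,y)$ with $x\in\{O,P\}$ (O-move/P-move) and $y\in\{Q,A\}$ (question/answer). A justified (j-)sequence is a finite sequence $s$ of moves with a map $\mathcal J_s:\{1,\dots,|s|\}\to\{0,\dots,|s|-1\}$, $\mathcal J_s(i)<i$ (occurrence $s(i)$ initial if $\mathcal J_s(i)=0$, otherwise justified by $s(\mathcal J_s(i))$). J-sequences are equal iff they have the same moves and pointers; prefixes inherit pointers; $X^{\mathrm{Even}}$, $X^{\mathrm{Odd}}$ are the even-/odd-length elements. The P-view $\lceil s\rceil$ and O-view $\lfloor s\rfloor$ are the j-subsequences given by $\lceil\epsilon\rceil=\epsilon$, $\lceil sm\rceil=\lceil s\rceil m$ ($m$ P-move), $\lceil sm\rceil=m$ ($m$ initial), $\lceil smtn\rceil=\lceil s\rceil mn$ ($n$ O-move justified by $m$), $\lfloor\epsilon\rfloor=\epsilon$, $\lfloor sm\rfloor=\lfloor s\rfloor m$ ($m$ O-move), $\lfloor smtn\rfloor=\lfloor s\rfloor mn$ ($n$ P-move justified by $m$). A legal position is a j-sequence with alternating O/P labels in which the justifier of each non-initial P-move (O-move) occurrence lies in the P-view (O-view) of the preceding prefix. A game is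 a pair $G=(P_G,\simeq_G)$ with $P_G$ a non-empty prefix-closed set of legal positions and $\simeq_G$ an equivalence relation on $P_G$ satisfying (I1) $s\simeq_G t\Rightarrow|s|=|t|$; (I2) $sm\simeq_G tn\Rightarrow s\simeq_G t$, $m,n$ carry the same labels and equal pointers; (I3) $s\simeq_G t\wedge sm\in P_G\Rightarrow\exists tn\in P_G.\ sm\simeq_G tn$; and whose induced arena (moves occurring in $P_G$, $\star\vdash_G m$ iff $m$ occurs initially, $m\vdash_G n$ iff $n$ occurs justified by $m$) has initial moves O-questions, answers enabled only by questions, non-$\star$ enabling flipping O/P labels, and no infinite chain $\star\vdash_G m_0\vdash_G m_1\vdash_G\cdots$. For a set $S$ of j-sequences, its induced arena $(M_S,\vdash_S)$ is defined likewise. A tree (t-)skeleton is a set $S$ of legal positions satisfying (Tree) $S\neq\emptyset$ and $sm\in S\Rightarrow s\in S$, (Edet) $smn,smn'\in S^{\mathrm{Even}}\Rightarrow smn=smn'$, with well-founded induced arena (no infinite chain $\star\vdash_S m_0\vdash_S m_1\vdash_S\cdots$). For sets $S,T$ of j-sequences, $\mathsf{Oinc}(S,T)$ means $S\subseteq T$ and $s\in S\wedge sm\in T^{\mathrm{Odd}}\Rightarrow sm\in S$. A t-skeleton on a pair $(P,\simeq)$ (in particular on a game) is a t-skeleton $S$ with $\mathsf{Oinc}(S,P)$. A non-empty set $\mathcal S$ of t-skeletons is consistent if the arena $(\bigcup_{\sigma\in\mathcal S}M_\sigma,\bigcup_{\sigma\in\mathcal S}\vdash_\sigma)$ has no infinite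 chain $\star\vdash m_0\vdash m_1\vdash\cdots$, and for all $\sigma,\tau\in\mathcal S$ and $sm\in(\sigma\cup\tau)^{\mathrm{Odd}}$, $s\in\sigma\cap\tau$ implies $sm\in\sigma\cap\tau$. A consistent pair is a pair $(\mathcal S,\simeq)$ of a consistent set $\mathcal S$ and an equivalence relation $\simeq$ on $\bigcup\mathcal S$ satisfying (I1)-(I3); its union game is $(\bigcup\mathcal S,\simeq)$. A consistent pair $(\mathcal S,\simeq)$ is complete if every subset $\mathcal A\subseteq\bigcup\mathcal S$ satisfying (Tree), (Edet) and $\mathsf{Oinc}(\mathcal A,\bigcup\mathcal S)$ is an element of $\mathcal S$. -}

module Defs where

open import Level using (Level; _⊔_; 0ℓ) renaming (suc to lsuc)
open import Data.Nat using (ℕ; zero; suc; _≤_; _≤ᵇ_)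
open import Data.Bool using (if_then_else_)
open import Data.Product using (Σ; ∃; _×_; _,_; proj₁; proj₂)
open import Data.Sum using (_⊎_)
open import Data.Unit using (⊤)
open import Relation.Nullary using (¬_)
open import Relation.Binary.PropositionalEquality using (_≡_; _≢_)
open import Relation.Unary using (Pred)
open import Relation.Binary using (Rel)

data Player : Set where
  O P : Player

data Kind : Set where
  question answer : Kind

Move : Set → Set
Move A = A × Player × Kind

player : ∀ {A} → Move A → Player
player (_ , x , _) = x

kind : ∀ {A} → Move A → Kind
kind (_ , _ , y) = y

-- an entry of a j-sequence: a move together with its pointer J(i)
-- (0 = initial, otherwise the 1-based position of the justifier)
Entry : Set → Set
Entry A = Move A × ℕ

-- j-sequences (raw), built by appending on the right: s ▷ e is "s e".
-- Validity of pointers (J(i) < i) is part of Legal below.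
infixl 5 _▷_
data JSeq (A : Set) : Set where
  ε   : JSeq A
  _▷_ : JSeq A → Entry A → JSeq A

len : ∀ {A} → JSeq A → ℕ
len ε = 0
len (s ▷ _) = suc (len s)

-- Occ s i e : the i-th (1-based) occurrence of s is the entry e
data Occ {A : Set} : JSeq A → ℕ → Entry A → Set where
  here  : ∀ {s e} → Occ (s ▷ e) (suc (len s)) e
  there : ∀ {s e e′ i} → Occ s i e′ → Occ (s ▷ e) i e′

prefix : ∀ {A} → ℕ → JSeq A → JSeq A
prefix k ε = ε
prefix k (s ▷ e) = if len (s ▷ e) ≤ᵇ k then s ▷ e else prefix k s

data EvenN : ℕ → Set
data OddN : ℕ → Set
data EvenN where
  ezero : EvenN 0
  esuc  : ∀ {n} → OddN n → EvenN (suc n)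
data OddN where
  osuc : ∀ {n} → EvenN n → OddN (suc n)

Even Odd : ∀ {A} → JSeq A → Set
Even s = EvenN (len s)
Odd s = OddN (len s)

-- Views, as the sets of positions of s they retain.

-- InPView s j : position j of s occurs in the P-view ⌈s⌉
data InPView {A : Set} : JSeq A → ℕ → Set where
  -- ⌈s m⌉ = ⌈s⌉ m   (m P-move)
  pv-P-old  : ∀ {s a y p j} → InPView s j → InPView (s ▷ ((a , P , y) , p)) j
  pv-P-new  : ∀ {s a y p} → InPView (s ▷ ((a , P , y) , p)) (suc (len s))
  -- ⌈s m⌉ = m   (m initial O-move)
  pv-init   : ∀ {s a y} → InPView (s ▷ ((a , O , y) , 0)) (suc (len s))
  -- ⌈s m t n⌉ = ⌈s⌉ m n   (n O-move justified by m, m at position suc k)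
  pv-O-new  : ∀ {s a y k} → InPView (s ▷ ((a , O , y) , suc k)) (suc (len s))
  pv-O-just : ∀ {s a y k} → InPView (s ▷ ((a , O , y) , suc k)) (suc k)
  pv-O-old  : ∀ {s a y k j} → InPView (prefix k s) j → InPView (s ▷ ((a , O , y) , suc k)) j

-- InOView s j : position j of s occurs in the O-view ⌊s⌋
data InOView {A : Set} : JSeq A → ℕ → Set where
  -- ⌊s m⌋ = ⌊s⌋ m   (m O-move)
  ov-O-old  : ∀ {s a y p j} → InOView s j → InOView (s ▷ ((a , O , y) , p)) j
  ov-O-new  : ∀ {s a y p} → InOView (s ▷ ((a , O , y) , p)) (suc (len s))
  -- initial P-move (not covered by the paper's equations): ⌊s n⌋ = ⌊s⌋ n
  ov-Pi-old : ∀ {s a y j} → InOView s j → InOView (s ▷ ((a , P , y) , 0)) j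
  ov-Pi-new : ∀ {s a y} → InOView (s ▷ ((a , P , y) , 0)) (suc (len s))
  -- ⌊s m t n⌋ = ⌊s⌋ m n   (n P-move justified by m, m at position suc k)
  ov-P-new  : ∀ {s a y k} → InOView (s ▷ ((a , P , y) , suc k)) (suc (len s))
  ov-P-just : ∀ {s a y k} → InOView (s ▷ ((a , P , y) , suc k)) (suc k)
  ov-P-old  : ∀ {s a y k j} → InOView (prefix k s) j → InOView (s ▷ ((a , P , y) , suc k)) j

Alternates : ∀ {A} → JSeq A → Move A → Set
Alternates ε m = ⊤
Alternates (s ▷ (m′ , _)) m = player m′ ≢ player m

Visible : ∀ {A} → JSeq A → Move A → ℕ → Set
Visible s m zero = ⊤
Visible s (a , P , y) (suc k) = InPView s (suc k)
Visible s (a , O , y) (suc k) = InOView s (suc k)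

Legal : ∀ {A} → JSeq A → Set
Legal ε = ⊤
Legal (s ▷ (m , p)) = Legal s × p ≤ len s × Alternates s m × Visible s m p

module _ {A : Set} where

  InitOf : ∀ {ℓ} → Pred (JSeq A) ℓ → Move A → Set ℓ
  InitOf S m = Σ (JSeq A) λ s → S s × Σ ℕ λ i → Occ s i (m , 0)

  EnOf : ∀ {ℓ} → Pred (JSeq A) ℓ → Move A → Move A → Set ℓ
  EnOf S m n = Σ (JSeq A) λ s → S s × Σ ℕ λ i → Σ ℕ λ j → Σ ℕ λ p →
                 Occ s i (m , p) × Occ s j (n , i)

  NoInfChain : ∀ {ℓ ℓ′} → (Move A → Set ℓ) → (Move A → Move A → Set ℓ′) → Set (ℓ ⊔ ℓ′)
  NoInfChain Init En = ¬ (Σ (ℕ → Move A) λ f → Init (f 0) × (∀ i → En (f i) (f (suc i))))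

  WellFoundedArena : ∀ {ℓ} → Pred (JSeq A) ℓ → Set ℓ
  WellFoundedArena S = NoInfChain (InitOf S) (EnOf S)

  NonEmpty : ∀ {ℓ} → Pred (JSeq A) ℓ → Set ℓ
  NonEmpty S = Σ (JSeq A) λ s → S s

  PrefixClosed : ∀ {ℓ} → Pred (JSeq A) ℓ → Set ℓ
  PrefixClosed S = ∀ s e → S (s ▷ e) → S s

  TreeCond : ∀ {ℓ} → Pred (JSeq A) ℓ → Set ℓ
  TreeCond S = NonEmpty S × PrefixClosed S

  Edet : ∀ {ℓ} → Pred (JSeq A) ℓ → Set ℓ
  Edet S = ∀ s m n n′ → Even (s ▷ m ▷ n) → S (s ▷ m ▷ n) → Even (s ▷ m ▷ n′) → S (s ▷ m ▷ n′)
           → (s ▷ m ▷ n) ≡ (s ▷ m ▷ n′)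

  AllLegal : ∀ {ℓ} → Pred (JSeq A) ℓ → Set ℓ
  AllLegal S = ∀ s → S s → Legal s

  _⊆′_ : ∀ {ℓ ℓ′} → Pred (JSeq A) ℓ → Pred (JSeq A) ℓ′ → Set (ℓ ⊔ ℓ′)
  S ⊆′ T = ∀ s → S s → T s

  Oinc : ∀ {ℓ ℓ′} → Pred (JSeq A) ℓ → Pred (JSeq A) ℓ′ → Set (ℓ ⊔ ℓ′)
  Oinc S T = (S ⊆′ T) × (∀ s e → S s → T (s ▷ e) → Odd (s ▷ e) → S (s ▷ e))

  IsTSkeleton : ∀ {ℓ} → Pred (JSeq A) ℓ → Set ℓ
  IsTSkeleton S = AllLegal S × TreeCond S × Edet S × WellFoundedArena S

  -- t-skeleton on a pair (Pos , ≃) (only Pos matters)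
  TSkeletonOn : ∀ {ℓ ℓ′} → Pred (JSeq A) ℓ → Pred (JSeq A) ℓ′ → Set (ℓ ⊔ ℓ′)
  TSkeletonOn S Pos = IsTSkeleton S × Oinc S Pos

  EquivOn : ∀ {ℓ ℓ′} → Pred (JSeq A) ℓ → Rel (JSeq A) ℓ′ → Set (ℓ ⊔ ℓ′)
  EquivOn Pos R = (∀ s t → R s t → Pos s × Pos t)
                × (∀ s → Pos s → R s s)
                × (∀ s t → R s t → R t s)
                × (∀ s t u → R s t → R t u → R s u)

  I1 : ∀ {ℓ′} → Rel (JSeq A) ℓ′ → Set ℓ′
  I1 R = ∀ s t → R s t → len s ≡ len t

  I2 : ∀ {ℓ′} → Rel (JSeq A) ℓ′ → Set ℓ′
  I2 R = ∀ s t m n p q → R (s ▷ (m , p)) (t ▷ (n , q))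
         → R s t × player m ≡ player n × kind m ≡ kind n × p ≡ q

  I3 : ∀ {ℓ ℓ′} → Pred (JSeq A) ℓ → Rel (JSeq A) ℓ′ → Set (ℓ ⊔ ℓ′)
  I3 Pos R = ∀ s t e → R s t → Pos (s ▷ e) → Σ (Entry A) λ e′ → Pos (t ▷ e′) × R (s ▷ e) (t ▷ e′)

  IsGame : ∀ {ℓ ℓ′} → Pred (JSeq A) ℓ → Rel (JSeq A) ℓ′ → Set (ℓ ⊔ ℓ′)
  IsGame Pos R =
      AllLegal Pos × TreeCond Pos
    × EquivOn Pos R × I1 R × I2 R × I3 Pos R
    × (∀ m → InitOf Pos m → player m ≡ O × kind m ≡ question)
    × (∀ m n → EnOf Pos m n → kind n ≡ answer → kind m ≡ question)
    × (∀ m n → EnOf Pos m n → player m ≢ player n)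
    × WellFoundedArena Pos

record Game (A : Set) : Set₁ where
  field
    pos   : Pred (JSeq A) 0ℓ
    _≃_   : Rel (JSeq A) 0ℓ
    isGame : IsGame pos _≃_

module _ {A : Set} where

  ts : Game A → Pred (Pred (JSeq A) 0ℓ) 0ℓ
  ts G σ = TSkeletonOn σ (Game.pos G)

  ⋃ : ∀ {ℓ ℓ′} → Pred (Pred (JSeq A) ℓ) ℓ′ → Pred (JSeq A) (lsuc ℓ ⊔ ℓ′)
  ⋃ 𝒮 s = Σ (Pred (JSeq A) _) λ σ → 𝒮 σ × σ s

  Consistent : ∀ {ℓ ℓ′} → Pred (Pred (JSeq A) ℓ) ℓ′ → Set (lsuc ℓ ⊔ ℓ′)
  Consistent 𝒮 =
      (∀ σ → 𝒮 σ → IsTSkeleton σ)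
    × (Σ (Pred (JSeq A) _) λ σ → 𝒮 σ)
    × NoInfChain (λ m → Σ (Pred (JSeq A) _) λ σ → 𝒮 σ × InitOf σ m)
                 (λ m n → Σ (Pred (JSeq A) _) λ σ → 𝒮 σ × EnOf σ m n)
    × (∀ σ τ → 𝒮 σ → 𝒮 τ → ∀ s e → Odd (s ▷ e) → (σ (s ▷ e) ⊎ τ (s ▷ e))
         → σ s × τ s → σ (s ▷ e) × τ (s ▷ e))

  ConsistentPair : ∀ {ℓ ℓ′ ℓ″} → Pred (Pred (JSeq A) ℓ) ℓ′ → Rel (JSeq A) ℓ″ → Set (lsuc ℓ ⊔ ℓ′ ⊔ ℓ″)
  ConsistentPair 𝒮 R = Consistent 𝒮 × EquivOn (⋃ 𝒮) R × I1 R × I2 R × I3 (⋃ 𝒮) R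

  CompletePair : ∀ {ℓ ℓ′ ℓ″} → Pred (Pred (JSeq A) ℓ) ℓ′ → Rel (JSeq A) ℓ″ → Set (lsuc ℓ ⊔ ℓ′ ⊔ ℓ″)
  CompletePair 𝒮 R = ConsistentPair 𝒮 R
    × (∀ (𝒜 : Pred (JSeq A) _) → 𝒜 ⊆′ ⋃ 𝒮 → TreeCond 𝒜 → Edet 𝒜 → Oinc 𝒜 (⋃ 𝒮) → 𝒮 𝒜)

{-# OPTIONS --safe #-}
module Submission where

open import Defs
open import Level using (0ℓ)
open import Data.Product using (_×_)
open import Relation.Unary using (Pred)
open import Relation.Binary using (Rel)
open import Function.Bundles using (_⇔_)

open import Data.Product using (Σ; _,_; proj₁; proj₂)
open import Data.Sum using (_⊎_; inj₁; inj₂; [_,_])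
open import Data.Empty using (⊥-elim)
open import Data.Nat using (suc; _≤_)
open import Data.Nat.Properties using (≤-refl; m≤n⇒m≤1+n; 1+n≰n)
open import Relation.Nullary using (¬_)
open import Relation.Binary.PropositionalEquality using (_≡_; refl; sym; subst)
open import Function.Bundles using (mk⇔)

-- The positions of G are exactly the positions of its t-skeletons: a position s lies in the
-- t-skeleton consisting of the prefixes of s together with their odd-length (O-move)
-- extensions in G, which is O-inclusive by construction and E-deterministic because its
-- even-length positions all lie on the single branch to s. Conversely a t-skeleton on G is a
-- subset of G, so every (Tree), (Edet), O-inclusive subset of G is again a t-skeleton on G:
-- legality and well-foundedness of the arena are inherited. For a complete pair, its members
-- are O-inclusive in the union by consistency, and completeness gives the converse.

even⇒¬odd : ∀ {n} → EvenN n → ¬ OddN n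
even⇒¬odd (esuc o) (osuc e) = even⇒¬odd e o

module _ {A : Set} where

  infix 4 _≼_
  data _≼_ : JSeq A → JSeq A → Set where
    ≼-refl : ∀ {s} → s ≼ s
    ≼-step : ∀ {s t e} → s ≼ t → s ≼ t ▷ e

  ≼-len : ∀ {s t} → s ≼ t → len s ≤ len t
  ≼-len ≼-refl = ≤-refl
  ≼-len (≼-step p) = m≤n⇒m≤1+n (≼-len p)

  ≼-init : ∀ {s t e} → s ▷ e ≼ t → s ≼ t
  ≼-init ≼-refl = ≼-step ≼-refl
  ≼-init (≼-step p) = ≼-step (≼-init p)

  ≼-unique : ∀ {u v s} → u ≼ s → v ≼ s → len u ≡ len v → u ≡ v
  ≼-unique ≼-refl ≼-refl _ = refl
  ≼-unique ≼-refl (≼-step q) eq = ⊥-elim (1+n≰n (subst (_≤ _) (sym eq) (≼-len q)))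
  ≼-unique (≼-step p) ≼-refl eq = ⊥-elim (1+n≰n (subst (_≤ _) eq (≼-len p)))
  ≼-unique (≼-step p) (≼-step q) eq = ≼-unique p q eq

  module _ {ℓ ℓ′} {S : Pred (JSeq A) ℓ} {T : Pred (JSeq A) ℓ′} (S⊆T : S ⊆′ T) where

    InitOf-mono : ∀ {m} → InitOf S m → InitOf T m
    InitOf-mono (s , Ss , occ) = s , S⊆T s Ss , occ

    EnOf-mono : ∀ {m n} → EnOf S m n → EnOf T m n
    EnOf-mono (s , Ss , occ) = s , S⊆T s Ss , occ

    WellFoundedArena-antimono : WellFoundedArena T → WellFoundedArena S
    WellFoundedArena-antimono wf (f , init , en) = wf (f , InitOf-mono init , λ i → EnOf-mono (en i))

  module _ {ℓ ℓ′} {S : Pred (JSeq A) ℓ} {T : Pred (JSeq A) ℓ′}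
           (S⊆T : S ⊆′ T) (T⊆S : T ⊆′ S) where

    EquivOn-resp : ∀ {ℓ″} {R : Rel (JSeq A) ℓ″} → EquivOn S R → EquivOn T R
    EquivOn-resp (onS , refl′ , sym′ , trans′) =
        (λ s t r → let (Ss , St) = onS s t r in S⊆T s Ss , S⊆T t St)
      , (λ s Ts → refl′ s (T⊆S s Ts))
      , sym′ , trans′

    I3-resp : ∀ {ℓ″} {R : Rel (JSeq A) ℓ″} → I3 S R → I3 T R
    I3-resp i3 s t e r Tse =
      let (e′ , Ste′ , r′) = i3 s t e r (T⊆S _ Tse) in e′ , S⊆T _ Ste′ , r′

    Oinc-resp : ∀ {ℓ″} {𝒜 : Pred (JSeq A) ℓ″} → Oinc 𝒜 S → Oinc 𝒜 T
    Oinc-resp (𝒜⊆S , odd) = (λ s 𝒜s → S⊆T s (𝒜⊆S s 𝒜s))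
                          , λ s e 𝒜s Tse → odd s e 𝒜s (T⊆S _ Tse)

  module _ {ℓ} {Pos : Pred (JSeq A) ℓ} where

    TSkeletonOn-intro : ∀ {ℓ′} {𝒜 : Pred (JSeq A) ℓ′} → AllLegal Pos → WellFoundedArena Pos →
                        TreeCond 𝒜 → Edet 𝒜 → Oinc 𝒜 Pos → TSkeletonOn 𝒜 Pos
    TSkeletonOn-intro legal wf tree edet oinc@(𝒜⊆Pos , _) =
      ( (λ s 𝒜s → legal s (𝒜⊆Pos s 𝒜s))
      , tree , edet , WellFoundedArena-antimono 𝒜⊆Pos wf)
      , oinc

    module _ {ℓ′ ℓ″} {𝒮 : Pred (Pred (JSeq A) ℓ′) ℓ″} (onPos : ∀ σ → 𝒮 σ → Oinc σ Pos) where

      ⋃-arena-noInfChain :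
        WellFoundedArena Pos →
        NoInfChain (λ m → Σ (Pred (JSeq A) ℓ′) λ σ → 𝒮 σ × InitOf σ m)
                   (λ m n → Σ (Pred (JSeq A) ℓ′) λ σ → 𝒮 σ × EnOf σ m n)
      ⋃-arena-noInfChain wf (f , (σ , 𝒮σ , init) , en) =
        wf (f , InitOf-mono (proj₁ (onPos σ 𝒮σ)) init , λ i → toPos (en i))
        where
          toPos : ∀ {m n} → (Σ (Pred (JSeq A) ℓ′) λ τ → 𝒮 τ × EnOf τ m n) → EnOf Pos m n
          toPos (τ , 𝒮τ , e) = EnOf-mono (proj₁ (onPos τ 𝒮τ)) e

      Oinc-agree : ∀ σ τ → 𝒮 σ → 𝒮 τ → ∀ s e → Odd (s ▷ e) → (σ (s ▷ e) ⊎ τ (s ▷ e))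
                   → σ s × τ s → σ (s ▷ e) × τ (s ▷ e)
      Oinc-agree σ τ 𝒮σ 𝒮τ s e odd σse⊎τse (σs , τs) =
        let (σ⊆Pos , σ-odd) = onPos σ 𝒮σ
            (τ⊆Pos , τ-odd) = onPos τ 𝒮τ
            Pos-se = [ σ⊆Pos _ , τ⊆Pos _ ] σse⊎τse
        in σ-odd s e σs Pos-se odd , τ-odd s e τs Pos-se odd

  data Branch (s : JSeq A) : JSeq A → Set where
    on-branch : ∀ {t} → t ≼ s → Branch s t
    O-step    : ∀ {t e} → t ≼ s → Odd (t ▷ e) → Branch s (t ▷ e)

  module _ {ℓ} {Pos : Pred (JSeq A) ℓ} (Pos-prefixClosed : PrefixClosed Pos) (s : JSeq A) where

    branchSkeleton : Pred (JSeq A) ℓ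
    branchSkeleton t = Pos t × Branch s t

    branchSkeleton-prefixClosed : PrefixClosed branchSkeleton
    branchSkeleton-prefixClosed t e (Pos-te , on-branch p) = Pos-prefixClosed t e Pos-te , on-branch (≼-init p)
    branchSkeleton-prefixClosed t e (Pos-te , O-step p _)  = Pos-prefixClosed t e Pos-te , on-branch p

    branchSkeleton-edet : Edet branchSkeleton
    branchSkeleton-edet t m n n′ _ (_ , on-branch p) _ (_ , on-branch q) = ≼-unique p q refl
    branchSkeleton-edet t m n n′ ev (_ , O-step _ odd) _ _ = ⊥-elim (even⇒¬odd ev odd)
    branchSkeleton-edet t m n n′ _ _ ev (_ , O-step _ odd) = ⊥-elim (even⇒¬odd ev odd)

    branchSkeleton-Oinc : Oinc branchSkeleton Pos
    branchSkeleton-Oinc = (λ t → proj₁) , extend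
      where
        extend : ∀ t e → branchSkeleton t → Pos (t ▷ e) → Odd (t ▷ e) → branchSkeleton (t ▷ e)
        extend t e (_ , on-branch p) Pos-te odd = Pos-te , O-step p odd
        extend t e (_ , O-step _ odd′) _ (osuc ev) = ⊥-elim (even⇒¬odd ev odd′)

module _ {A : Set} (G : Game A) where
  open Game G

  private
    legal : AllLegal pos
    legal = let (legal , _) = isGame in legal

    tree : TreeCond pos
    tree = let (_ , tree , _) = isGame in tree

    equiv : EquivOn pos _≃_
    equiv = let (_ , _ , equiv , _) = isGame in equiv

    i1 : I1 _≃_
    i1 = let (_ , _ , _ , i1 , _) = isGame in i1

    i2 : I2 _≃_
    i2 = let (_ , _ , _ , _ , i2 , _) = isGame in i2

    i3 : I3 pos _≃_
    i3 = let (_ , _ , _ , _ , _ , i3 , _) = isGame in i3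

    wf : WellFoundedArena pos
    wf = let (_ , _ , _ , _ , _ , _ , _ , _ , _ , wf) = isGame in wf

  ⋃ts⊆pos : ⋃ (ts G) ⊆′ pos
  ⋃ts⊆pos s (σ , (_ , (σ⊆pos , _)) , σs) = σ⊆pos s σs

  ts-intro : ∀ {𝒜} → TreeCond 𝒜 → Edet 𝒜 → Oinc 𝒜 pos → ts G 𝒜
  ts-intro = TSkeletonOn-intro legal wf

  branchSkeleton-ts : ∀ s → pos s → ts G (branchSkeleton (proj₂ tree) s)
  branchSkeleton-ts s pos-s = ts-intro
    ((s , pos-s , on-branch ≼-refl) , branchSkeleton-prefixClosed (proj₂ tree) s)
    (branchSkeleton-edet (proj₂ tree) s)
    (branchSkeleton-Oinc (proj₂ tree) s)

  pos⊆⋃ts : pos ⊆′ ⋃ (ts G)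
  pos⊆⋃ts s pos-s = branchSkeleton (proj₂ tree) s , branchSkeleton-ts s pos-s , pos-s , on-branch ≼-refl

  ts-consistent : Consistent (ts G)
  ts-consistent =
      (λ σ → proj₁)
    , (_ , branchSkeleton-ts _ (proj₂ (proj₁ tree)))
    , ⋃-arena-noInfChain (λ σ → proj₂) wf
    , Oinc-agree (λ σ → proj₂)

  ts-complete : CompletePair (ts G) _≃_
  ts-complete =
      ( ts-consistent
      , EquivOn-resp pos⊆⋃ts ⋃ts⊆pos equiv
      , i1 , i2
      , I3-resp pos⊆⋃ts ⋃ts⊆pos i3)
    , λ 𝒜 _ tree-𝒜 edet-𝒜 oinc-𝒜 → ts-intro tree-𝒜 edet-𝒜 (Oinc-resp ⋃ts⊆pos pos⊆⋃ts oinc-𝒜)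

module _ {A : Set} {ℓ ℓ′} {𝒮 : Pred (Pred (JSeq A) ℓ) ℓ′} where

  member⇒TSkeletonOn⋃ : Consistent 𝒮 → ∀ {σ} → 𝒮 σ → TSkeletonOn σ (⋃ 𝒮)
  member⇒TSkeletonOn⋃ (skeletons , _ , _ , agree) {σ} 𝒮σ =
    skeletons σ 𝒮σ , (λ s σs → σ , 𝒮σ , σs) , extend
    where
      extend : ∀ s e → σ s → ⋃ 𝒮 (s ▷ e) → Odd (s ▷ e) → σ (s ▷ e)
      extend s e σs (τ , 𝒮τ , τse) odd =
        let (_ , (_ , τ-prefixClosed) , _) = skeletons τ 𝒮τ
        in proj₁ (agree σ τ 𝒮σ 𝒮τ s e odd (inj₂ τse) (σs , τ-prefixClosed s e τse))

module _ {A : Set} {𝒮 : Pred (Pred (JSeq A) 0ℓ) 0ℓ} {R : Rel (JSeq A) 0ℓ} where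

  TSkeletonOn⋃⇔member : CompletePair 𝒮 R → ∀ σ → TSkeletonOn σ (⋃ 𝒮) ⇔ 𝒮 σ
  TSkeletonOn⋃⇔member ((consistent , _) , complete) σ = mk⇔
    (λ ((_ , tree , edet , _) , oinc) → complete σ (proj₁ oinc) tree edet oinc)
    (member⇒TSkeletonOn⋃ consistent)

mainTheorem6 : {A : Set} →
    ((G : Game A) →
        CompletePair (ts G) (Game._≃_ G)
      × (Game.pos G ⊆′ ⋃ (ts G))
      × (⋃ (ts G) ⊆′ Game.pos G))
    × ((𝒮 : Pred (Pred (JSeq A) 0ℓ) 0ℓ) (R : Rel (JSeq A) 0ℓ) → CompletePair 𝒮 R →
        (σ : Pred (JSeq A) 0ℓ) → (TSkeletonOn σ (⋃ 𝒮) ⇔ 𝒮 σ))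
mainTheorem6 =
    (λ G → ts-complete G , pos⊆⋃ts G , ⋃ts⊆pos G)
  , λ 𝒮 R → TSkeletonOn⋃⇔member
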